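{- Let $l\ge0$ be an integer. If an $(l+1)$-UM-critical tree has no vertex of degree at least $3$, then it is the path with $2^l$ vertices.
   Context: For a graph $G$, a unique-maximum coloring w.r.t. paths is a function $C\colon V(G)\to\{1,\dots,c\}$ such that for the vertex set of every path of $G$ (including single vertices) the maximum color on it occurs exactly once; $\mathrm{UM}(G)$ is the minimum such $c$. A graph is UM-critical if every proper subgraph has smaller UM; it is $k$-UM-critical if moreover its UM equals $k$. -}

module Defs where

open import Data.Nat using (ℕ; zero; suc; _<_; _≤_; _+_)
open import Data.Fin using (Fin; toℕ)
open import Data.Bool using (Bool; true; false; if_then_else_)
open import Data.List using (List; []; _∷_; length; map; allFin)
open import Data.Nat.ListAction using (sum)
open import Data.List.Membership.Propositional using (_∈_)
open import Data.List.Relation.Unary.Unique.Propositional using (Unique)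
open import Data.Product using (Σ; ∃; _×_; _,_)
open import Data.Sum using (_⊎_)
open import Relation.Binary.PropositionalEquality using (_≡_; _≢_; refl)
open import Relation.Nullary using (¬_)

record Graph : Set where
  field
    n      : ℕ
    adj    : Fin n → Fin n → Bool
    sym    : ∀ u v → adj u v ≡ adj v u
    irrefl : ∀ u → adj u u ≡ false
open Graph public

data Walk (G : Graph) : Fin (n G) → Fin (n G) → List (Fin (n G)) → Set where
  single : ∀ {u} → Walk G u u (u ∷ [])
  step   : ∀ {u w v p} → adj G u w ≡ true → Walk G w v p → Walk G u v (u ∷ p)

IsPath : (G : Graph) → List (Fin (n G)) → Set
IsPath G p = Σ (Fin (n G)) λ u → Σ (Fin (n G)) λ v → Walk G u v p × Unique p

UniqueMax : ∀ {m c} → (Fin m → Fin c) → List (Fin m) → Set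
UniqueMax C p = Σ _ λ x → x ∈ p × (∀ y → y ∈ p → y ≢ x → toℕ (C y) < toℕ (C x))

IsUMColoring : (G : Graph) (c : ℕ) → (Fin (n G) → Fin c) → Set
IsUMColoring G c C = ∀ p → IsPath G p → UniqueMax C p

HasUMColoring : Graph → ℕ → Set
HasUMColoring G c = Σ (Fin (n G) → Fin c) λ C → IsUMColoring G c C

UMIs : Graph → ℕ → Set
UMIs G k = HasUMColoring G k × (∀ c → HasUMColoring G c → k ≤ c)

record SubgraphVia (H G : Graph) (f : Fin (n H) → Fin (n G)) : Set where
  field
    inj      : ∀ u v → f u ≡ f v → u ≡ v
    edgePres : ∀ u v → adj H u v ≡ true → adj G (f u) (f v) ≡ true

-- Proper: H misses a vertex or an edge of G.
ProperSubgraphVia : (H G : Graph) (f : Fin (n H) → Fin (n G)) → Set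
ProperSubgraphVia H G f =
  SubgraphVia H G f ×
  ¬ ((n H ≡ n G) × (∀ u v → adj G (f u) (f v) ≡ true → adj H u v ≡ true))

IsUMCritical : Graph → ℕ → Set
IsUMCritical G k =
  UMIs G k ×
  (∀ (H : Graph) (f : Fin (n H) → Fin (n G)) → ProperSubgraphVia H G f →
     Σ ℕ λ c → c < k × UMIs H c)

Connected : Graph → Set
Connected G = ∀ u v → Σ _ λ p → Walk G u v p

HasCycle : Graph → Set
HasCycle G = Σ _ λ u → Σ _ λ v → Σ _ λ p →
  Walk G u v p × Unique p × 3 ≤ length p × adj G v u ≡ true

IsTree : Graph → Set
IsTree G = Connected G × ¬ HasCycle G

degree : (G : Graph) → Fin (n G) → ℕ
degree G v = sum (map (λ w → if adj G v w then 1 else 0) (allFin (n G)))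

Isomorphic : Graph → Graph → Set
Isomorphic G H = Σ (Fin (n G) → Fin (n H)) λ f →
  (∀ u v → f u ≡ f v → u ≡ v) ×
  (∀ y → Σ _ λ x → f x ≡ y) ×
  (∀ u v → adj G u v ≡ adj H (f u) (f v))

-- The path graph P_m on Fin m: i ~ j iff |i - j| = 1.
isZero : ℕ → Bool
isZero zero = true
isZero (suc _) = false

pathAdjℕ : ℕ → ℕ → Bool
pathAdjℕ zero zero = false
pathAdjℕ zero (suc b) = isZero b
pathAdjℕ (suc a) zero = isZero a
pathAdjℕ (suc a) (suc b) = pathAdjℕ a b

pathAdjℕ-sym : ∀ a b → pathAdjℕ a b ≡ pathAdjℕ b a
pathAdjℕ-sym zero zero = refl
pathAdjℕ-sym zero (suc b) = refl
pathAdjℕ-sym (suc a) zero = refl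
pathAdjℕ-sym (suc a) (suc b) = pathAdjℕ-sym a b

pathAdjℕ-irrefl : ∀ a → pathAdjℕ a a ≡ false
pathAdjℕ-irrefl zero = refl
pathAdjℕ-irrefl (suc a) = pathAdjℕ-irrefl a

PathGraph : ℕ → Graph
PathGraph m = record
  { n = m
  ; adj = λ i j → pathAdjℕ (toℕ i) (toℕ j)
  ; sym = λ i j → pathAdjℕ-sym (toℕ i) (toℕ j)
  ; irrefl = λ i → pathAdjℕ-irrefl (toℕ i)
  }

-- A tree without vertices of degree 3 is a path P_m. A UM colouring of a path on 2^k
-- vertices needs more than k colours, since the unique maximum of a run of 2^k vertices
-- leaves a run of 2^(k-1) vertices on one side; conversely, when m < 2^l the ruler colouring
-- i ↦ ν₂(i + 1) colours P_m with l colours. Criticality thus excludes m < 2^l, and also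
-- m > 2^l, because deleting an end vertex leaves a proper subgraph that still contains a
-- path on 2^l vertices.

module Submission where

open import Defs hiding (sym)
open import Data.Nat
  using (ℕ; zero; suc; _<_; _≤_; _+_; _∸_; _^_; z≤n; s≤s; s≤s⁻¹; _≤?_; _≟_; ⌊_/2⌋; compare; less; equal; greater)
open import Data.Nat.Properties
open import Data.Nat.ListAction using (sum)
open import Data.Fin using (Fin; toℕ; fromℕ<; inject₁) renaming (zero to fzero; suc to fsuc)
open import Data.Fin.Properties
  using (toℕ<n; toℕ-fromℕ<; toℕ-injective; inject₁-injective; toℕ-inject₁; cantor-schröder-bernstein; any?; injective⇒≤)
  renaming (_≟_ to _≟ᶠ_)
open import Data.Bool using (Bool; true; false; if_then_else_) renaming (_≟_ to _≟ᵇ_)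
open import Data.Bool.Properties using (¬-not)
open import Data.List using (List; []; _∷_; length; map; tabulate)
open import Data.List.Properties using (map-tabulate)
open import Data.List.Membership.Propositional using (_∈_)
open import Data.List.Membership.Propositional.Properties using (∈-map⁺; ∈-map⁻)
open import Data.List.Relation.Unary.Any using (here; there)
open import Data.List.Relation.Unary.All as All using ([])
open import Data.List.Relation.Unary.AllPairs using ([]; _∷_)
open import Data.List.Relation.Unary.Unique.Propositional using (Unique)
open import Data.List.Relation.Unary.Unique.Propositional.Properties using (map⁺)
open import Data.List.Extrema ≤-totalOrder using (argmax; argmax-all; f[⊥]≤f[argmax]; f[xs]≤f[argmax])
open import Data.Product using (∃-syntax; _×_; _,_; proj₁; proj₂)
open import Data.Sum using (_⊎_; inj₁; inj₂; [_,_]′)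
open import Function using (_∘_)
open import Relation.Binary using (tri<; tri≈; tri>)
open import Relation.Binary.PropositionalEquality
open import Relation.Nullary using (¬_; Dec; yes; no; contradiction; ¬?)
open import Relation.Nullary.Decidable using (_×-dec_)

-- Paths as vertex sequences

-- The path at 0, at 1, …, at len; the values of at beyond len are irrelevant.
record IndexedPath (G : Graph) : Set where
  field
    len          : ℕ
    at           : ℕ → Fin (n G)
    at-injective : ∀ i j → i ≤ len → j ≤ len → at i ≡ at j → i ≡ j
    at-adjacent  : ∀ i → i < len → adj G (at i) (at (suc i)) ≡ true
open IndexedPath public

segment : ∀ {A : Set} → (ℕ → A) → ℕ → ℕ → List A
segment f i zero    = f i ∷ []
segment f i (suc d) = f i ∷ segment f (suc i) d

module _ {A : Set} (f : ℕ → A) where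

  ∈-segment⁺ : ∀ i d t → t ≤ d → f (i + t) ∈ segment f i d
  ∈-segment⁺ i zero    zero    _         = here (cong f (+-identityʳ i))
  ∈-segment⁺ i (suc d) zero    _         = here (cong f (+-identityʳ i))
  ∈-segment⁺ i (suc d) (suc t) (s≤s t≤d) =
    there (subst (_∈ segment f (suc i) d) (cong f (sym (+-suc i t))) (∈-segment⁺ (suc i) d t t≤d))

  ∈-segment⁻ : ∀ i d {x} → x ∈ segment f i d → ∃[ t ] t ≤ d × x ≡ f (i + t)
  ∈-segment⁻ i zero    (here refl) = 0 , z≤n , cong f (sym (+-identityʳ i))
  ∈-segment⁻ i (suc d) (here refl) = 0 , z≤n , cong f (sym (+-identityʳ i))
  ∈-segment⁻ i (suc d) (there x∈) with ∈-segment⁻ (suc i) d x∈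
  ... | t , t≤d , refl = suc t , s≤s t≤d , cong f (sym (+-suc i t))

  length-segment : ∀ i d → length (segment f i d) ≡ suc d
  length-segment i zero    = refl
  length-segment i (suc d) = cong suc (length-segment (suc i) d)

module _ {G : Graph} (P : IndexedPath G) where

  segment-walk : ∀ i d → i + d ≤ len P → Walk G (at P i) (at P (i + d)) (segment (at P) i d)
  segment-walk i zero    _  rewrite +-identityʳ i = single
  segment-walk i (suc d) le rewrite +-suc i d =
    step (at-adjacent P i (≤-trans (s≤s (m≤m+n i d)) le)) (segment-walk (suc i) d le)

  segment-unique : ∀ i d → i + d ≤ len P → Unique (segment (at P) i d)
  segment-unique i zero    _  = [] ∷ []
  segment-unique i (suc d) le = All.tabulate head-fresh ∷ segment-unique (suc i) d le′
    where
    le′ : suc i + d ≤ len P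
    le′ = ≤-trans (≤-reflexive (sym (+-suc i d))) le
    head-fresh : ∀ {x} → x ∈ segment (at P) (suc i) d → at P i ≢ x
    head-fresh x∈ eq with ∈-segment⁻ (at P) (suc i) d x∈
    ... | t , t≤d , refl =
      m≢1+m+n i (at-injective P i (suc i + t) (≤-trans (m≤m+n i (suc d)) le)
                   (≤-trans (+-monoʳ-≤ (suc i) t≤d) le′) eq)

  segment-isPath : ∀ i d → i + d ≤ len P → IsPath G (segment (at P) i d)
  segment-isPath i d le = at P i , at P (i + d) , segment-walk i d le , segment-unique i d le

-- Lower bound on the number of colours

2^k≤s⊎2^k≤r : ∀ k s r → 2 ^ suc k ≤ suc (s + r) → 2 ^ k ≤ s ⊎ 2 ^ k ≤ r
2^k≤s⊎2^k≤r k s r big with 2 ^ k ≤? s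
... | yes left = inj₁ left
... | no  s≱  = inj₂ (+-cancelˡ-≤ (2 ^ k) _ _ (begin
  2 ^ k + 2 ^ k       ≡⟨ cong (2 ^ k +_) (sym (+-identityʳ (2 ^ k))) ⟩
  2 ^ suc k           ≤⟨ big ⟩
  suc s + r           ≤⟨ +-monoˡ-≤ r (≰⇒> s≱) ⟩
  2 ^ k + r           ∎))
  where open ≤-Reasoning

module _ {G : Graph} (P : IndexedPath G) {c : ℕ} {C : Fin (n G) → Fin c}
         (um : IsUMColoring G c C) where

  private
    colour : ℕ → ℕ
    colour j = toℕ (C (at P j))

  segment-uniqueMax : ∀ i d → i + d ≤ len P →
    ∃[ s ] s ≤ d × (∀ t → t ≤ d → t ≢ s → colour (i + t) < colour (i + s))
  segment-uniqueMax i d le with um (segment (at P) i d) (segment-isPath P i d le)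
  ... | x , x∈ , max with ∈-segment⁻ (at P) i d x∈
  ... | s , s≤d , refl = s , s≤d , λ t t≤d t≢s →
    max _ (∈-segment⁺ (at P) i d t t≤d) (t≢s ∘ +-cancelˡ-≡ i _ _ ∘ at-injective P _ _ (inside t≤d) (inside s≤d))
    where
    inside : ∀ {t} → t ≤ d → i + t ≤ len P
    inside t≤d = ≤-trans (+-monoʳ-≤ i t≤d) le

  -- The unique maximum of a run splits it into two runs, one of which has at least 2^(k-1) vertices.
  segment-colour≥ : ∀ k i e → i + e ≤ suc (len P) → 2 ^ k ≤ e → ∃[ t ] t < e × k ≤ colour (i + t)
  segment-colour≥ zero    i e       _  1≤e = 0 , 1≤e , z≤n
  segment-colour≥ (suc k) i zero    _  big = contradiction big (<⇒≱ (m^n>0 2 (suc k)))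
  segment-colour≥ (suc k) i (suc d) le big
    with segment-uniqueMax i d (s≤s⁻¹ (≤-trans (≤-reflexive (sym (+-suc i d))) le))
  ... | s , s≤d , below with m≤n⇒∃[o]m+o≡n s≤d
  ... | r , refl = [ from-left , from-right ]′ (2^k≤s⊎2^k≤r k s r big)
    where
    from-left : 2 ^ k ≤ s → ∃[ t ] t < suc (s + r) × suc k ≤ colour (i + t)
    from-left left =
      let t , t<s , k≤ = segment-colour≥ k i s (≤-trans (+-monoʳ-≤ i (m≤n⇒m≤1+n s≤d)) le) left
      in s , s≤s s≤d , ≤-<-trans k≤ (below t (≤-trans (<⇒≤ t<s) s≤d) (<⇒≢ t<s))
    from-right : 2 ^ k ≤ r → ∃[ t ] t < suc (s + r) × suc k ≤ colour (i + t)
    from-right right =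
      let t , t<r , k≤ = segment-colour≥ k (i + suc s) r (≤-trans (≤-reflexive (+-assoc i (suc s) r)) le) right
      in s , s≤s s≤d ,
         ≤-<-trans (≤-trans k≤ (≤-reflexive (cong colour (+-assoc i (suc s) t))))
                   (below (suc s + t) (≤-trans (≤-reflexive (sym (+-suc s t))) (+-monoʳ-≤ s t<r))
                          (≢-sym (m≢1+m+n s)))

  2^k≤vertices⇒k<colours : ∀ k → 2 ^ k ≤ suc (len P) → k < c
  2^k≤vertices⇒k<colours k big with segment-colour≥ k 0 (suc (len P)) ≤-refl big
  ... | t , _ , k≤ = ≤-<-trans k≤ (toℕ<n _)

-- The ruler function

data Parity : ℕ → Set where
  even : ∀ k → Parity (k + k)
  odd  : ∀ k → Parity (suc (k + k))

parity : ∀ n → Parity n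
parity zero = even 0
parity (suc n) with parity n
... | even k = odd k
... | odd k  = subst Parity (cong suc (+-suc k k)) (even (suc k))

isOdd : ℕ → Bool
isOdd zero          = false
isOdd (suc zero)    = true
isOdd (suc (suc n)) = isOdd n

-- ruler′ f n counts the trailing 1-bits of n, i.e. the 2-adic valuation of n + 1;
-- the fuel f is sufficient as soon as f ≥ n.
ruler′ : ℕ → ℕ → ℕ
ruler′ _       zero    = 0
ruler′ zero    (suc _) = 0
ruler′ (suc f) (suc n) = if isOdd (suc n) then suc (ruler′ f ⌊ suc n /2⌋) else 0

ruler : ℕ → ℕ
ruler n = ruler′ n n

ruler′-fuel : ∀ f g n → n ≤ f → n ≤ g → ruler′ f n ≡ ruler′ g n
ruler′-fuel _       _       zero    _         _         = refl
ruler′-fuel (suc f) (suc g) (suc n) (s≤s n≤f) (s≤s n≤g) with isOdd (suc n)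
... | false = refl
... | true  = cong suc (ruler′-fuel f g _ (≤-trans half≤n n≤f) (≤-trans half≤n n≤g))
  where
  half≤n : ⌊ suc n /2⌋ ≤ n
  half≤n = s≤s⁻¹ (⌊n/2⌋<n n)

isOdd-even : ∀ k → isOdd (k + k) ≡ false
isOdd-even zero    = refl
isOdd-even (suc k) rewrite +-suc k k = isOdd-even k

isOdd-odd : ∀ k → isOdd (suc (k + k)) ≡ true
isOdd-odd zero    = refl
isOdd-odd (suc k) rewrite +-suc k k = isOdd-odd k

⌊1+k+k/2⌋≡k : ∀ k → ⌊ suc (k + k) /2⌋ ≡ k
⌊1+k+k/2⌋≡k zero    = refl
⌊1+k+k/2⌋≡k (suc k) rewrite +-suc k k = cong suc (⌊1+k+k/2⌋≡k k)

ruler-even : ∀ k → ruler (k + k) ≡ 0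
ruler-even zero    = refl
ruler-even (suc k) rewrite +-suc k k | isOdd-even k = refl

ruler-odd : ∀ k → ruler (suc (k + k)) ≡ suc (ruler k)
ruler-odd k rewrite isOdd-odd k | ⌊1+k+k/2⌋≡k k = cong suc (ruler′-fuel (k + k) k k (m≤m+n k k) ≤-refl)

k+k<k′+k′⇒k<k′ : ∀ {k k′} → k + k < k′ + k′ → k < k′
k+k<k′+k′⇒k<k′ h = ≰⇒> λ k′≤k → <⇒≱ h (+-mono-≤ k′≤k k′≤k)

k<k′⇒1+k+k<k′+k′ : ∀ {k k′} → k < k′ → suc (k + k) < k′ + k′
k<k′⇒1+k+k<k′+k′ {k} k<k′ = ≤-trans (≤-reflexive (cong suc (sym (+-suc k k)))) (+-mono-≤ k<k′ k<k′)

ruler< : ∀ l i → suc i < 2 ^ l → ruler i < l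
ruler< zero    i (s≤s ())
ruler< (suc l) i i<2^l with parity i
... | even k rewrite ruler-even k = s≤s z≤n
... | odd k  rewrite ruler-odd k  = s≤s (ruler< l k (k+k<k′+k′⇒k<k′ doubled))
  where
  doubled : suc k + suc k < 2 ^ l + 2 ^ l
  doubled = subst₂ _<_ (cong suc (sym (+-suc k k))) (cong (2 ^ l +_) (+-identityʳ (2 ^ l))) i<2^l

ruler-gap : ∀ r {a b} → a < b → ruler a ≡ r → ruler b ≡ r → ∃[ z ] a < z × z < b × r < ruler z
ruler-gap r {a} {b} a<b ra rb with parity a | parity b
ruler-gap r       a<b ra rb | even k | even k′ =
  suc (k + k) , ≤-refl , k<k′⇒1+k+k<k′+k′ (k+k<k′+k′⇒k<k′ {k} {k′} a<b) ,
  subst₂ _<_ (trans (sym (ruler-even k)) ra) (sym (ruler-odd k)) (s≤s z≤n)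
ruler-gap r       a<b ra rb | even k | odd k′ =
  contradiction (trans (sym (ruler-odd k′)) (trans rb (trans (sym ra) (ruler-even k)))) λ ()
ruler-gap r       a<b ra rb | odd k  | even k′ =
  contradiction (trans (sym (ruler-odd k)) (trans ra (trans (sym rb) (ruler-even k′)))) λ ()
ruler-gap zero    a<b ra rb | odd k  | odd k′ = contradiction (trans (sym (ruler-odd k)) ra) λ ()
ruler-gap (suc r) a<b ra rb | odd k  | odd k′
  with ruler-gap r {k} {k′} (k+k<k′+k′⇒k<k′ (s≤s⁻¹ a<b))
         (suc-injective (trans (sym (ruler-odd k)) ra)) (suc-injective (trans (sym (ruler-odd k′)) rb))
... | z , k<z , z<k′ , r<z =
  suc (z + z) , s≤s (+-mono-< k<z k<z) , s≤s (+-mono-< z<k′ z<k′) ,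
  subst (suc r <_) (sym (ruler-odd z)) (s≤s r<z)

-- UM colourings of path graphs

pathAdjℕ-suc : ∀ i → pathAdjℕ i (suc i) ≡ true
pathAdjℕ-suc zero    = refl
pathAdjℕ-suc (suc i) = pathAdjℕ-suc i

pathAdjℕ-+ : ∀ i k → pathAdjℕ i (suc (i + k)) ≡ isZero k
pathAdjℕ-+ zero    k = refl
pathAdjℕ-+ (suc i) k = pathAdjℕ-+ i k

pathAdjℕ⇒≤1+ : ∀ a b → pathAdjℕ a b ≡ true → b ≤ suc a × a ≤ suc b
pathAdjℕ⇒≤1+ zero          (suc zero)    _ = ≤-refl , z≤n
pathAdjℕ⇒≤1+ (suc zero)    zero          _ = z≤n , ≤-refl
pathAdjℕ⇒≤1+ (suc a)       (suc b)       e with pathAdjℕ⇒≤1+ a b e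
... | b≤ , a≤ = s≤s b≤ , s≤s a≤

PathGraph-indexedPath : ∀ L → IndexedPath (PathGraph (suc L))
PathGraph-indexedPath L = record
  { len          = L
  ; at           = position
  ; at-injective = λ i j i≤L j≤L eq → trans (sym (toℕ-position i≤L)) (trans (cong toℕ eq) (toℕ-position j≤L))
  ; at-adjacent  = λ i i<L → trans (cong₂ pathAdjℕ (toℕ-position (<⇒≤ i<L)) (toℕ-position i<L)) (pathAdjℕ-suc i)
  }
  where
  position : ℕ → Fin (suc L)
  position i with i ≤? L
  ... | yes i≤L = fromℕ< (s≤s i≤L)
  ... | no  _   = fzero
  toℕ-position : ∀ {i} → i ≤ L → toℕ (position i) ≡ i
  toℕ-position {i} i≤L with i ≤? L
  ... | yes _   = toℕ-fromℕ< _
  ... | no  i≰L = contradiction i≤L i≰L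

PathGraph-2^k≤⇒k< : ∀ {M c} → HasUMColoring (PathGraph M) c → ∀ k → 2 ^ k ≤ M → k < c
PathGraph-2^k≤⇒k< {zero}  _        k big = contradiction big (<⇒≱ (m^n>0 2 k))
PathGraph-2^k≤⇒k< {suc L} (C , um) k big = 2^k≤vertices⇒k<colours (PathGraph-indexedPath L) um k big

uniqueMax-of-gaps : ∀ {m c} (C : Fin m → Fin c) {a as} →
  (∀ {x y} → x ∈ a ∷ as → y ∈ a ∷ as → x ≢ y → toℕ (C x) ≡ toℕ (C y) →
     ∃[ w ] w ∈ a ∷ as × toℕ (C x) < toℕ (C w)) →
  UniqueMax C (a ∷ as)
uniqueMax-of-gaps {m} C {a} {as} gap = top , top∈ , λ y y∈ y≢top → ≤∧≢⇒< (≤top y∈) λ eq →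
  let w , w∈ , lt = gap y∈ top∈ y≢top eq in <⇒≱ lt (≤-trans (≤top w∈) (≤-reflexive (sym eq)))
  where
  colour : Fin m → ℕ
  colour v = toℕ (C v)
  top : Fin m
  top = argmax colour a as
  top∈ : top ∈ a ∷ as
  top∈ = argmax-all colour (here refl) (All.tabulate there)
  ≤top : ∀ {y} → y ∈ a ∷ as → colour y ≤ colour top
  ≤top (here refl) = f[⊥]≤f[argmax] {f = colour} a as
  ≤top (there y∈)  = All.lookup (f[xs]≤f[argmax] {f = colour} a as) y∈

walk-nonempty : ∀ {G a b p} → Walk G a b p → ∃[ rest ] p ≡ a ∷ rest
walk-nonempty single     = _ , refl
walk-nonempty (step _ _) = _ , refl

walk-head : ∀ {G a b p} → Walk G a b p → a ∈ p
walk-head single     = here refl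
walk-head (step _ _) = here refl

walk-intermediate : ∀ {M a b p} → Walk (PathGraph M) a b p → ∀ {x y z} → x ∈ p → y ∈ p →
  toℕ x ≤ z → z ≤ toℕ y → ∃[ w ] w ∈ p × toℕ w ≡ z
walk-intermediate single (here refl) (here refl) x≤z z≤y = _ , here refl , ≤-antisym x≤z z≤y
walk-intermediate (step e walk) (there x∈) (there y∈) x≤z z≤y
  with walk-intermediate walk x∈ y∈ x≤z z≤y
... | w , w∈ , refl = w , there w∈ , refl
walk-intermediate {a = a} (step e walk) {z = z} (here refl) y∈ x≤z z≤y with toℕ a ≟ z
... | yes a≡z = a , here refl , a≡z
... | no a≢z with y∈
...   | here refl = contradiction (≤-antisym x≤z z≤y) a≢z
...   | there y∈′
  with walk-intermediate walk (walk-head walk) y∈′ (≤-trans (proj₁ (pathAdjℕ⇒≤1+ _ _ e)) (≤∧≢⇒< x≤z a≢z)) z≤y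
...     | w , w∈ , refl = w , there w∈ , refl
walk-intermediate {a = a} (step e walk) {z = z} (there x∈) (here refl) x≤z z≤y with z ≟ toℕ a
... | yes z≡a = a , here refl , sym z≡a
... | no z≢a
  with walk-intermediate walk x∈ (walk-head walk) x≤z (s≤s⁻¹ (≤-trans (≤∧≢⇒< z≤y z≢a) (proj₂ (pathAdjℕ⇒≤1+ _ _ e))))
...   | w , w∈ , refl = w , there w∈ , refl

rulerColouring : ∀ {M l} → M < 2 ^ l → Fin M → Fin l
rulerColouring {l = l} M<2^l v = fromℕ< (ruler< l (toℕ v) (≤-<-trans (toℕ<n v) M<2^l))

rulerColouring-isUM : ∀ {M l} (M<2^l : M < 2 ^ l) → IsUMColoring (PathGraph M) l (rulerColouring M<2^l)
rulerColouring-isUM {M} {l} M<2^l p (u , _ , walk , _) with walk-nonempty walk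
... | rest , refl = uniqueMax-of-gaps C gap
  where
  C : Fin M → Fin l
  C = rulerColouring M<2^l
  colour≡ruler : ∀ v → toℕ (C v) ≡ ruler (toℕ v)
  colour≡ruler v = toℕ-fromℕ< _

  ordered-gap : ∀ {x y r} → x ∈ u ∷ rest → y ∈ u ∷ rest → toℕ x < toℕ y →
    ruler (toℕ x) ≡ r → ruler (toℕ y) ≡ r → ∃[ w ] w ∈ u ∷ rest × r < toℕ (C w)
  ordered-gap x∈ y∈ x<y rx ry with ruler-gap _ x<y rx ry
  ... | z , x<z , z<y , lt with walk-intermediate walk x∈ y∈ (<⇒≤ x<z) (<⇒≤ z<y)
  ...   | w , w∈ , refl = w , w∈ , subst (_ <_) (sym (colour≡ruler w)) lt

  gap : ∀ {x y} → x ∈ u ∷ rest → y ∈ u ∷ rest → x ≢ y → toℕ (C x) ≡ toℕ (C y) →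
    ∃[ w ] w ∈ u ∷ rest × toℕ (C x) < toℕ (C w)
  gap {x} {y} x∈ y∈ x≢y eq with <-cmp (toℕ x) (toℕ y)
  ... | tri< x<y _ _ = ordered-gap x∈ y∈ x<y (sym (colour≡ruler x)) (trans (sym (colour≡ruler y)) (sym eq))
  ... | tri≈ _ x≡y _ = contradiction (toℕ-injective x≡y) x≢y
  ... | tri> _ _ y<x = ordered-gap y∈ x∈ y<x (trans (sym (colour≡ruler y)) (sym eq)) (sym (colour≡ruler x))

-- Subgraphs and isomorphisms

module _ {H G : Graph} {f : Fin (n H) → Fin (n G)} (H⊆G : SubgraphVia H G f) where
  open SubgraphVia H⊆G

  walk-map : ∀ {u v p} → Walk H u v p → Walk G (f u) (f v) (map f p)
  walk-map single     = single
  walk-map (step e w) = step (edgePres _ _ e) (walk-map w)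

  isPath-map : ∀ {p} → IsPath H p → IsPath G (map f p)
  isPath-map (u , v , walk , unique) = f u , f v , walk-map walk , map⁺ (inj _ _) unique

  isUMColoring-restrict : ∀ {c C} → IsUMColoring G c C → IsUMColoring H c (C ∘ f)
  isUMColoring-restrict {C = C} um p p-path with um (map f p) (isPath-map p-path)
  ... | _ , fx∈ , max with ∈-map⁻ f fx∈
  ... | x , x∈ , refl = x , x∈ , λ y y∈ y≢x → max (f y) (∈-map⁺ f y∈) (y≢x ∘ inj y x)

  hasUMColoring-restrict : ∀ {c} → HasUMColoring G c → HasUMColoring H c
  hasUMColoring-restrict (C , um) = C ∘ f , isUMColoring-restrict um

SubgraphVia-∘ : ∀ {K H G f g} → SubgraphVia H G f → SubgraphVia K H g → SubgraphVia K G (f ∘ g)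
SubgraphVia-∘ H⊆G K⊆H = record
  { inj      = λ u v → K.inj u v ∘ H.inj _ _
  ; edgePres = λ u v → H.edgePres _ _ ∘ K.edgePres u v
  }
  where
  module H = SubgraphVia H⊆G
  module K = SubgraphVia K⊆H

module _ {G H : Graph} where

  Isomorphic⇒SubgraphVia : (G≅H : Isomorphic G H) → SubgraphVia G H (proj₁ G≅H)
  Isomorphic⇒SubgraphVia (_ , inj , _ , adj≡) = record
    { inj = inj ; edgePres = λ u v e → trans (sym (adj≡ u v)) e }

  Isomorphic⁻¹ : Isomorphic G H → Fin (n H) → Fin (n G)
  Isomorphic⁻¹ (_ , _ , surj , _) y = proj₁ (surj y)

  Isomorphic⁻¹-SubgraphVia : (G≅H : Isomorphic G H) → SubgraphVia H G (Isomorphic⁻¹ G≅H)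
  Isomorphic⁻¹-SubgraphVia (f , _ , surj , adj≡) = record
    { inj      = λ y y′ eq → trans (sym (section y)) (trans (cong f eq) (section y′))
    ; edgePres = λ y y′ e → trans (adj≡ _ _)
                   (subst₂ (λ a b → adj H a b ≡ true) (sym (section y)) (sym (section y′)) e)
    }
    where
    section : ∀ y → f (proj₁ (surj y)) ≡ y
    section y = proj₂ (surj y)

  Isomorphic⇒≡ : Isomorphic G H → n G ≡ n H
  Isomorphic⇒≡ G≅H = cantor-schröder-bernstein
    (SubgraphVia.inj (Isomorphic⇒SubgraphVia G≅H) _ _)
    (SubgraphVia.inj (Isomorphic⁻¹-SubgraphVia G≅H) _ _)

PathGraph-inject₁ : ∀ k → SubgraphVia (PathGraph k) (PathGraph (suc k)) inject₁
PathGraph-inject₁ k = record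
  { inj      = λ _ _ → inject₁-injective
  ; edgePres = λ u v → subst₂ (λ a b → pathAdjℕ a b ≡ true) (sym (toℕ-inject₁ u)) (sym (toℕ-inject₁ v))
  }

-- Trees without vertices of degree 3 are paths

sum-tabulate≥₁ : ∀ {m} (h : Fin m → ℕ) a → h a ≤ sum (tabulate h)
sum-tabulate≥₁ h fzero    = m≤m+n _ _
sum-tabulate≥₁ h (fsuc a) = ≤-trans (sum-tabulate≥₁ (h ∘ fsuc) a) (m≤n+m _ (h fzero))

sum-tabulate≥₂ : ∀ {m} (h : Fin m → ℕ) a b → a ≢ b → h a + h b ≤ sum (tabulate h)
sum-tabulate≥₂ h fzero    fzero    a≢b = contradiction refl a≢b
sum-tabulate≥₂ h fzero    (fsuc b) _   = +-monoʳ-≤ (h fzero) (sum-tabulate≥₁ (h ∘ fsuc) b)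
sum-tabulate≥₂ h (fsuc a) fzero    _   =
  ≤-trans (≤-reflexive (+-comm _ (h fzero))) (+-monoʳ-≤ (h fzero) (sum-tabulate≥₁ (h ∘ fsuc) a))
sum-tabulate≥₂ h (fsuc a) (fsuc b) a≢b =
  ≤-trans (sum-tabulate≥₂ (h ∘ fsuc) a b (a≢b ∘ cong fsuc)) (m≤n+m _ (h fzero))

sum-tabulate≥₃ : ∀ {m} (h : Fin m → ℕ) a b c → a ≢ b → a ≢ c → b ≢ c →
  h a + h b + h c ≤ sum (tabulate h)
sum-tabulate≥₃ h fzero    fzero    _        a≢b _   _   = contradiction refl a≢b
sum-tabulate≥₃ h fzero    (fsuc b) fzero    _   a≢c _   = contradiction refl a≢c
sum-tabulate≥₃ h (fsuc a) fzero    fzero    _   _   b≢c = contradiction refl b≢c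
sum-tabulate≥₃ h fzero    (fsuc b) (fsuc c) _   _   b≢c =
  ≤-trans (≤-reflexive (+-assoc (h fzero) _ _))
          (+-monoʳ-≤ (h fzero) (sum-tabulate≥₂ (h ∘ fsuc) b c (b≢c ∘ cong fsuc)))
sum-tabulate≥₃ h (fsuc a) fzero    (fsuc c) _   a≢c _   =
  ≤-trans (≤-reflexive (trans (cong (_+ h (fsuc c)) (+-comm _ (h fzero))) (+-assoc (h fzero) _ _)))
          (+-monoʳ-≤ (h fzero) (sum-tabulate≥₂ (h ∘ fsuc) a c (a≢c ∘ cong fsuc)))
sum-tabulate≥₃ h (fsuc a) (fsuc b) fzero    a≢b _   _   =
  ≤-trans (≤-reflexive (+-comm _ (h fzero)))
          (+-monoʳ-≤ (h fzero) (sum-tabulate≥₂ (h ∘ fsuc) a b (a≢b ∘ cong fsuc)))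
sum-tabulate≥₃ h (fsuc a) (fsuc b) (fsuc c) a≢b a≢c b≢c =
  ≤-trans (sum-tabulate≥₃ (h ∘ fsuc) a b c (a≢b ∘ cong fsuc) (a≢c ∘ cong fsuc) (b≢c ∘ cong fsuc))
          (m≤n+m _ (h fzero))

degree≥3 : ∀ G v {a b c} → a ≢ b → a ≢ c → b ≢ c →
  adj G v a ≡ true → adj G v b ≡ true → adj G v c ≡ true → 3 ≤ degree G v
degree≥3 G v {a} {b} {c} a≢b a≢c b≢c va vb vc = begin
  3                           ≡⟨ cong₂ _+_ (cong₂ _+_ (cong indicator va) (cong indicator vb)) (cong indicator vc) ⟨
  h a + h b + h c             ≤⟨ sum-tabulate≥₃ h a b c a≢b a≢c b≢c ⟩
  sum (tabulate h)            ≡⟨ cong sum (map-tabulate (λ w → w) h) ⟨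
  degree G v                  ∎
  where
  open ≤-Reasoning
  indicator : Bool → ℕ
  indicator x = if x then 1 else 0
  h : Fin (n G) → ℕ
  h w = indicator (adj G v w)

module _ {G : Graph} where

  infix 4 _∈ᴾ_ _∈ᴾ?_

  _∈ᴾ_ : Fin (n G) → IndexedPath G → Set
  w ∈ᴾ P = ∃[ i ] i ≤ len P × at P i ≡ w

  _∈ᴾ?_ : ∀ w P → Dec (w ∈ᴾ P)
  w ∈ᴾ? P with any? (λ (i : Fin (suc (len P))) → at P (toℕ i) ≟ᶠ w)
  ... | yes (i , eq) = yes (toℕ i , s≤s⁻¹ (toℕ<n i) , eq)
  ... | no ∄        = no λ (i , i≤ , eq) → ∄ (fromℕ< (s≤s i≤) , trans (cong (at P) (toℕ-fromℕ< _)) eq)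

  Closed : IndexedPath G → ℕ → Set
  Closed P i = ∀ w → adj G (at P i) w ≡ true → w ∈ᴾ P

  Extends : IndexedPath G → IndexedPath G → Set
  Extends P Q = ∃[ d ] len Q ≡ d + len P × (∀ i → at Q (d + i) ≡ at P i)

  extends-∈ᴾ : ∀ {P Q w} → Extends P Q → w ∈ᴾ P → w ∈ᴾ Q
  extends-∈ᴾ (d , lenQ , atQ) (i , i≤ , refl) =
    d + i , ≤-trans (+-monoʳ-≤ d i≤) (≤-reflexive (sym lenQ)) , atQ i

  1+len≤n : (P : IndexedPath G) → suc (len P) ≤ n G
  1+len≤n P = injective⇒≤ {f = at P ∘ toℕ}
    (toℕ-injective ∘ at-injective P _ _ (s≤s⁻¹ (toℕ<n _)) (s≤s⁻¹ (toℕ<n _)))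

  singleton : Fin (n G) → IndexedPath G
  singleton x = record
    { len = 0 ; at = λ _ → x ; at-injective = λ { _ _ z≤n z≤n _ → refl } ; at-adjacent = λ _ () }

  prepend : ∀ w P → adj G w (at P 0) ≡ true → ¬ w ∈ᴾ P → IndexedPath G
  prepend w P e w∉ = record { len = suc (len P) ; at = at′ ; at-injective = injective ; at-adjacent = adjacent }
    where
    at′ : ℕ → Fin (n G)
    at′ zero    = w
    at′ (suc i) = at P i
    injective : ∀ i j → i ≤ suc (len P) → j ≤ suc (len P) → at′ i ≡ at′ j → i ≡ j
    injective zero    zero    _         _         _  = refl
    injective zero    (suc j) _         (s≤s j≤) eq = contradiction (j , j≤ , sym eq) w∉
    injective (suc i) zero    (s≤s i≤) _         eq = contradiction (i , i≤ , eq) w∉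
    injective (suc i) (suc j) (s≤s i≤) (s≤s j≤) eq = cong suc (at-injective P i j i≤ j≤ eq)
    adjacent : ∀ i → i < suc (len P) → adj G (at′ i) (at′ (suc i)) ≡ true
    adjacent zero    _         = e
    adjacent (suc i) (s≤s i<) = at-adjacent P i i<

  reverse : IndexedPath G → IndexedPath G
  reverse P = record
    { len          = len P
    ; at           = λ i → at P (len P ∸ i)
    ; at-injective = λ i j i≤ j≤ → ∸-cancelˡ-≡ i≤ j≤ ∘ at-injective P _ _ (m∸n≤m _ i) (m∸n≤m _ j)
    ; at-adjacent  = adjacent
    }
    where
    adjacent : ∀ i → i < len P → adj G (at P (len P ∸ i)) (at P (len P ∸ suc i)) ≡ true
    adjacent i i< = begin
      adj G (at P (len P ∸ i)) (at P j)      ≡⟨ cong (λ t → adj G (at P t) (at P j)) len∸i≡1+j ⟩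
      adj G (at P (suc j)) (at P j)          ≡⟨ Graph.sym G _ _ ⟩
      adj G (at P j) (at P (suc j))          ≡⟨ at-adjacent P j (≤-trans (≤-reflexive (sym len∸i≡1+j)) (m∸n≤m _ i)) ⟩
      true                                   ∎
      where
      open ≡-Reasoning
      j : ℕ
      j = len P ∸ suc i
      len∸i≡1+j : len P ∸ i ≡ suc j
      len∸i≡1+j = +-∸-assoc 1 i<

  reverse-∈ᴾ : ∀ {P w} → w ∈ᴾ P → w ∈ᴾ reverse P
  reverse-∈ᴾ {P} (i , i≤ , refl) = len P ∸ i , m∸n≤m _ i , cong (at P) (m∸[m∸n]≡n i≤)

  -- The fuel k bounds the number of prepending steps; it never runs out since a path
  -- has at most n G vertices.
  extendAtHead : ∀ k P → n G < suc (len P) + k → ∃[ Q ] Closed Q 0 × Extends P Q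
  extendAtHead zero    P long = contradiction (1+len≤n P) (<⇒≱ (≤-trans long (≤-reflexive (+-identityʳ _))))
  extendAtHead (suc k) P long with any? (λ w → (adj G (at P 0) w ≟ᵇ true) ×-dec ¬? (w ∈ᴾ? P))
  ... | yes (w , e , w∉)
    with extendAtHead k (prepend w P (trans (Graph.sym G w _) e) w∉) (≤-trans long (≤-reflexive (+-suc _ k)))
  ...   | Q , closed , d , lenQ , atQ =
    Q , closed , suc d , trans lenQ (+-suc d (len P)) , λ i → trans (cong (at Q) (sym (+-suc d i))) (atQ (suc i))
  extendAtHead (suc k) P long | no ∄ = P , closed , 0 , refl , λ _ → refl
    where
    closed : Closed P 0
    closed w e with w ∈ᴾ? P
    ... | yes w∈ = w∈
    ... | no  w∉ = contradiction (w , e , w∉) ∄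

  maximalPath : Fin (n G) → ∃[ P ] Closed P 0 × Closed P (len P)
  maximalPath x with extendAtHead (n G) (singleton x) (n<1+n _)
  ... | P₁ , closed₁ , _ with extendAtHead (n G) (reverse P₁) (s≤s (m≤n+m _ _))
  ... | Q , closedQ , ext@(d , lenQ , atQ) = Q , closedQ , closed-last
    where
    last≡ : at Q (len Q) ≡ at P₁ 0
    last≡ = trans (cong (at Q) lenQ) (trans (atQ (len P₁)) (cong (at P₁) (n∸n≡0 (len P₁))))
    closed-last : Closed Q (len Q)
    closed-last w e = extends-∈ᴾ {reverse P₁} {Q} ext (reverse-∈ᴾ {P₁} (closed₁ w (subst (λ v → adj G v w ≡ true) last≡ e)))

spanning-path⇒Isomorphic : ∀ {G} (P : IndexedPath G) → (∀ w → w ∈ᴾ P) →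
  (∀ i j → i ≤ len P → j ≤ len P → adj G (at P i) (at P j) ≡ pathAdjℕ i j) →
  Isomorphic G (PathGraph (suc (len P)))
spanning-path⇒Isomorphic {G} P spans adj≡ = φ , injective , surjective , λ u v → begin
  adj G u v                               ≡⟨ cong₂ (adj G) (sym (at-index u)) (sym (at-index v)) ⟩
  adj G (at P (index u)) (at P (index v)) ≡⟨ adj≡ _ _ (index≤ u) (index≤ v) ⟩
  pathAdjℕ (index u) (index v)            ≡⟨ cong₂ pathAdjℕ (toℕ-φ u) (toℕ-φ v) ⟨
  pathAdjℕ (toℕ (φ u)) (toℕ (φ v))        ∎
  where
  open ≡-Reasoning
  index : Fin (n G) → ℕ
  index w = proj₁ (spans w)
  index≤ : ∀ w → index w ≤ len P
  index≤ w = proj₁ (proj₂ (spans w))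
  at-index : ∀ w → at P (index w) ≡ w
  at-index w = proj₂ (proj₂ (spans w))
  φ : Fin (n G) → Fin (suc (len P))
  φ w = fromℕ< (s≤s (index≤ w))
  toℕ-φ : ∀ w → toℕ (φ w) ≡ index w
  toℕ-φ w = toℕ-fromℕ< _
  injective : ∀ u v → φ u ≡ φ v → u ≡ v
  injective u v eq = trans (sym (at-index u)) (trans (cong (at P) index≡) (at-index v))
    where
    index≡ : index u ≡ index v
    index≡ = trans (sym (toℕ-φ u)) (trans (cong toℕ eq) (toℕ-φ v))
  surjective : ∀ y → ∃[ x ] φ x ≡ y
  surjective y = at P (toℕ y) , toℕ-injective (trans (toℕ-φ _)
    (at-injective P _ _ (index≤ _) (s≤s⁻¹ (toℕ<n y)) (at-index _)))

module _ {G : Graph} (tree : IsTree G) (deg<3 : ∀ v → degree G v < 3) (P : IndexedPath G) where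

  chordless : ∀ i e → i + suc (suc e) ≤ len P → adj G (at P i) (at P (i + suc (suc e))) ≡ false
  chordless i e le = ¬-not λ chord → proj₂ tree
    ( at P i , at P (i + suc (suc e)) , segment (at P) i (suc (suc e))
    , segment-walk P i _ le , segment-unique P i _ le
    , ≤-trans (s≤s (s≤s (s≤s z≤n))) (≤-reflexive (sym (length-segment (at P) i (suc (suc e)))))
    , trans (Graph.sym G _ _) chord )

  at-adj-suc : ∀ i k → suc (i + k) ≤ len P → adj G (at P i) (at P (suc (i + k))) ≡ pathAdjℕ i (suc (i + k))
  at-adj-suc i zero    le rewrite pathAdjℕ-+ i 0 | +-identityʳ i = at-adjacent P i le
  at-adj-suc i (suc e) le rewrite pathAdjℕ-+ i (suc e) | sym (+-suc i (suc e)) = chordless i e le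

  at-adj : ∀ i j → i ≤ len P → j ≤ len P → adj G (at P i) (at P j) ≡ pathAdjℕ i j
  at-adj i j i≤ j≤ with compare i j
  ... | less    .i k = at-adj-suc i k j≤
  ... | equal   .i   = trans (Graph.irrefl G _) (sym (pathAdjℕ-irrefl i))
  ... | greater .j k = trans (Graph.sym G _ _) (trans (at-adj-suc j k i≤) (pathAdjℕ-sym j _))

  -- An interior vertex already has its two path neighbours, so a third one would give degree 3.
  closed-everywhere : Closed P 0 → Closed P (len P) → ∀ i → i ≤ len P → Closed P i
  closed-everywhere closed₀ _ zero _ = closed₀
  closed-everywhere _ closedₗ (suc i) i< w e with w ∈ᴾ? P | suc i ≟ len P
  ... | yes w∈ | _      = w∈
  ... | no  _  | yes eq = closedₗ w (subst (λ t → adj G (at P t) w ≡ true) eq e)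
  ... | no  w∉ | no  ne = contradiction
    (degree≥3 G (at P (suc i)) prev≢next (λ eq → w∉ (i , <⇒≤ i< , eq)) (λ eq → w∉ (suc (suc i) , next< , eq))
       (trans (Graph.sym G _ _) (at-adjacent P i i<)) (at-adjacent P (suc i) next<) e)
    (<⇒≱ (deg<3 _))
    where
    next< : suc (suc i) ≤ len P
    next< = ≤∧≢⇒< i< ne
    prev≢next : at P i ≢ at P (suc (suc i))
    prev≢next eq = <-irrefl (at-injective P _ _ (<⇒≤ i<) next< eq) (s≤s (n≤1+n i))

  walk-stays : (∀ i → i ≤ len P → Closed P i) → ∀ {a b p} → Walk G a b p → a ∈ᴾ P → b ∈ᴾ P
  walk-stays closed single     a∈              = a∈
  walk-stays closed (step e w) (i , i≤ , refl) = walk-stays closed w (closed i i≤ _ e)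

  spanning : Closed P 0 → Closed P (len P) → ∀ w → w ∈ᴾ P
  spanning closed₀ closedₗ w =
    walk-stays (closed-everywhere closed₀ closedₗ) (proj₂ (proj₁ tree (at P 0) w)) (0 , z≤n , refl)

Fin⊎¬Fin : ∀ k → Fin k ⊎ ¬ Fin k
Fin⊎¬Fin zero    = inj₂ λ ()
Fin⊎¬Fin (suc k) = inj₁ fzero

tree-maxDegree<3⇒path : ∀ {G} → IsTree G → (∀ v → degree G v < 3) → ∃[ m ] Isomorphic G (PathGraph m)
tree-maxDegree<3⇒path {G} tree deg<3 with Fin⊎¬Fin (n G)
... | inj₂ ∄ = 0 , (λ v → contradiction v ∄) , (λ u → contradiction u ∄) , (λ ()) , (λ u → contradiction u ∄)
... | inj₁ x with maximalPath x
... | P , closed₀ , closedₗ =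
  suc (len P) , spanning-path⇒Isomorphic P (spanning tree deg<3 P closed₀ closedₗ) (at-adj tree deg<3 P)

-- UM-critical paths

UM-critical-path-≥2^l : ∀ {G l m} → IsUMCritical G (l + 1) → Isomorphic G (PathGraph m) → 2 ^ l ≤ m
UM-critical-path-≥2^l {l = l} ((_ , minimal) , _) G≅Pₘ = ≮⇒≥ λ m<2^l → contradiction
  (minimal l (hasUMColoring-restrict (Isomorphic⇒SubgraphVia G≅Pₘ) (_ , rulerColouring-isUM m<2^l)))
  (m+1+n≰m l)

UM-critical-path-≤2^l : ∀ {G l m} → IsUMCritical G (l + 1) → Isomorphic G (PathGraph m) → m ≤ 2 ^ l
UM-critical-path-≤2^l {m = zero} _ _ = z≤n
UM-critical-path-≤2^l {G} {l} {suc k} (_ , critical) G≅Pₘ = ≮⇒≥ λ 2^l<1+k →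
  let c , c<l+1 , (colouring , _) = critical (PathGraph k) (G⇽Pₘ ∘ inject₁) Pₖ⊂G
  in <⇒≱ (≤-trans c<l+1 (≤-reflexive (+-comm l 1))) (PathGraph-2^k≤⇒k< colouring l (s≤s⁻¹ 2^l<1+k))
  where
  G⇽Pₘ : Fin (suc k) → Fin (n G)
  G⇽Pₘ = Isomorphic⁻¹ {G} {PathGraph (suc k)} G≅Pₘ
  Pₖ⊂G : ProperSubgraphVia (PathGraph k) G (G⇽Pₘ ∘ inject₁)
  Pₖ⊂G = SubgraphVia-∘ (Isomorphic⁻¹-SubgraphVia G≅Pₘ) (PathGraph-inject₁ k) ,
         λ (k≡nG , _) → 1+n≢n (trans (sym (Isomorphic⇒≡ {G} {PathGraph (suc k)} G≅Pₘ)) (sym k≡nG))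

proposition2 : ∀ (l : ℕ) (G : Graph) → IsUMCritical G (l + 1) → IsTree G →
    (∀ v → degree G v < 3) → Isomorphic G (PathGraph (2 ^ l))
proposition2 l G critical tree deg<3 with tree-maxDegree<3⇒path tree deg<3
... | m , G≅Pₘ = subst (Isomorphic G ∘ PathGraph) m≡2^l G≅Pₘ
  where
  m≡2^l : m ≡ 2 ^ l
  m≡2^l = ≤-antisym (UM-critical-path-≤2^l {G} critical G≅Pₘ) (UM-critical-path-≥2^l {G} critical G≅Pₘ)
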